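{- Let $G=\mathbb{Z}_4^n$. Then there is a set $A\subset G$ containing no proper three-term arithmetic progressions with $|A| = \Omega(|G|^{2/3})$ (with an absolute implied constant).
   Context: $\mathbb{Z}_4=\mathbb{Z}/4\mathbb{Z}$. A three-term arithmetic progression in $G$ is a triple $(x,x+d,x+2d)$ with $x,d\in G$; it is proper if its three elements are distinct, i.e. $2d\neq 0_G$. -}

module Defs where

open import Data.Nat using (ℕ; suc; _+_; _*_; _^_; _≥_)
open import Data.Nat.DivMod using (_%_; m%n<n)
open import Data.Fin using (Fin; toℕ; fromℕ<; zero)
open import Data.Vec using (Vec; zipWith; replicate)
open import Data.List using (List; length)
open import Data.List.Membership.Propositional using (_∈_)
open import Data.List.Relation.Unary.Unique.Propositional using (Unique)
open import Data.Product using (Σ; _×_)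
open import Relation.Binary.PropositionalEquality using (_≡_)
open import Relation.Nullary using (¬_)
open import Data.Empty using (⊥)

ℤ₄ : Set
ℤ₄ = Fin 4

_+₄_ : ℤ₄ → ℤ₄ → ℤ₄
a +₄ b = fromℕ< (m%n<n (toℕ a + toℕ b) 4)

G : ℕ → Set
G n = Vec ℤ₄ n

_⊕_ : ∀ {n} → G n → G n → G n
_⊕_ = zipWith _+₄_

0G : ∀ {n} → G n
0G {n} = replicate n zero

-- A (given as a duplicate-free list of elements of G) contains no proper
-- three-term AP (x, x+d, x+2d) with 2d ≠ 0.
NoProper3AP : ∀ {n} → List (G n) → Set
NoProper3AP {n} A = ∀ (x d : G n) → ¬ ((d ⊕ d) ≡ 0G) →
  x ∈ A → (x ⊕ d) ∈ A → ((x ⊕ d) ⊕ d) ∈ A → ⊥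

module Submission where

-- The idea: the property "no proper three-term progression" is preserved by
-- Cartesian products A × A′ ⊆ ℤ₄ᵏ × ℤ₄ᵐ = ℤ₄ᵏ⁺ᵐ, because a difference
-- d = (d₁ , d₂) with 2d ≠ 0 has 2d₁ ≠ 0 or 2d₂ ≠ 0, and then the progression
-- projects onto a proper progression in A or in A′.  Taking powers of one
-- 16-element progression-free set B ⊆ ℤ₄³ (note 16 = |ℤ₄³|^{2/3}) gives, for
-- n = 3m + r with r ≤ 2, the set Bᵐ × {0} ⊆ ℤ₄ⁿ of size 16ᵐ, whose cube
-- 4096ᵐ = 16^{3m} is at least 16ⁿ / 256.

open import Defs
open import Data.Nat using (ℕ; _*_; _^_; _≥_; _≤_; zero; suc; _+_; z≤n; s≤s)
open import Data.Nat.Properties using (m≤m+n; ≤-refl; *-monoʳ-≤; ^-distribˡ-+-*; module ≤-Reasoning)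
open import Data.Nat.Solver using (module +-*-Solver)
open import Data.Fin using (zero; #_)
open import Data.Fin.Properties using (all?) renaming (_≟_ to _≟F_)
open import Data.Vec using ([]; _∷_; _++_; splitAt)
open import Data.Vec.Properties using (≡-dec; ++-injective; zipWith-++; ∷-injectiveˡ; ∷-injectiveʳ)
open import Data.List using (List; []; _∷_; [_]; length; map; cartesianProductWith)
open import Data.List.Properties using (length-++; length-map)
open import Data.List.Membership.Propositional using (_∈_)
open import Data.List.Membership.Propositional.Properties using (∈-cartesianProductWith⁻)
open import Data.List.Relation.Unary.Any using (here)
open import Data.List.Relation.Unary.Unique.Propositional using (Unique)
open import Data.List.Relation.Unary.AllPairs using ([]; _∷_)
open import Data.List.Relation.Unary.All using ([])
open import Data.List.Relation.Unary.Unique.Propositional.Properties using (cartesianProductWith⁺)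
import Data.List.Relation.Unary.Unique.DecPropositional as UniqueDec
import Data.List.Membership.DecPropositional as MembershipDec
open import Data.Product using (Σ; _×_; _,_)
open import Relation.Nullary using (Dec; yes; no; ¬?)
open import Relation.Nullary.Decidable using (map′; _→-dec_; from-yes)
open import Relation.Binary.Definitions using (DecidableEquality)
open import Relation.Binary.PropositionalEquality using (_≡_; refl; sym; trans; cong; cong₂; subst; module ≡-Reasoning)
open import Relation.Unary using (Pred; Decidable)

_≟G_ : ∀ {n} → DecidableEquality (G n)
_≟G_ = ≡-dec _≟F_

all-G? : ∀ {n p} {P : Pred (G n) p} → Decidable P → Dec (∀ v → P v)
all-G? {zero}  P? = map′ (λ P[] → λ { [] → P[] }) (λ ∀P → ∀P []) (P? [])
all-G? {suc n} P? = map′ (λ ∀P → λ { (a ∷ v) → ∀P a v }) (λ ∀P a v → ∀P (a ∷ v))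
  (all? λ a → all-G? λ v → P? (a ∷ v))

noProper3AP? : ∀ {n} (A : List (G n)) → Dec (NoProper3AP A)
noProper3AP? A = all-G? λ x → all-G? λ d →
  ¬? ((d ⊕ d) ≟G 0G) →-dec (x ∈? A) →-dec ((x ⊕ d) ∈? A) →-dec (((x ⊕ d) ⊕ d) ∈? A) →-dec no λ ()
  where open MembershipDec _≟G_

B : List (G 3)
B =
  (# 0 ∷ # 0 ∷ # 0 ∷ []) ∷ (# 0 ∷ # 0 ∷ # 1 ∷ []) ∷ (# 0 ∷ # 1 ∷ # 0 ∷ []) ∷
  (# 0 ∷ # 1 ∷ # 2 ∷ []) ∷ (# 0 ∷ # 2 ∷ # 1 ∷ []) ∷ (# 0 ∷ # 2 ∷ # 2 ∷ []) ∷
  (# 1 ∷ # 1 ∷ # 1 ∷ []) ∷ (# 1 ∷ # 1 ∷ # 3 ∷ []) ∷ (# 1 ∷ # 3 ∷ # 1 ∷ []) ∷ (# 1 ∷ # 3 ∷ # 3 ∷ []) ∷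
  (# 2 ∷ # 0 ∷ # 2 ∷ []) ∷ (# 2 ∷ # 0 ∷ # 3 ∷ []) ∷ (# 2 ∷ # 2 ∷ # 0 ∷ []) ∷
  (# 2 ∷ # 2 ∷ # 3 ∷ []) ∷ (# 2 ∷ # 3 ∷ # 0 ∷ []) ∷ (# 2 ∷ # 3 ∷ # 2 ∷ []) ∷ []

B-noProper3AP : NoProper3AP B
B-noProper3AP = from-yes (noProper3AP? B)

B-unique : Unique B
B-unique = from-yes (UniqueDec.unique? _≟G_ B)

_⊗_ : ∀ {k n} → List (G k) → List (G n) → List (G (k + n))
As ⊗ Bs = cartesianProductWith _++_ As Bs

length-cartesianProductWith : ∀ {a b c} {A : Set a} {B : Set b} {C : Set c} (f : A → B → C) xs ys →
  length (cartesianProductWith f xs ys) ≡ length xs * length ys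
length-cartesianProductWith f []       ys = refl
length-cartesianProductWith f (x ∷ xs) ys = trans (length-++ (map (f x) ys))
  (cong₂ _+_ (length-map (f x) ys) (length-cartesianProductWith f xs ys))

⊗-unique : ∀ {k n} {As : List (G k)} {Bs : List (G n)} → Unique As → Unique Bs → Unique (As ⊗ Bs)
⊗-unique = cartesianProductWith⁺ _++_ (λ {w} {x} eq → ++-injective w x eq)

∈-⊗⁻ : ∀ {k n} {As : List (G k)} {Bs : List (G n)} {a b} → a ++ b ∈ As ⊗ Bs → a ∈ As × b ∈ Bs
∈-⊗⁻ {As = As} {Bs} {a} ab∈ with a′ , b′ , a′∈ , b′∈ , eq ← ∈-cartesianProductWith⁻ _++_ As Bs ab∈
  with refl , refl ← ++-injective a a′ eq = a′∈ , b′∈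

⊕-++ : ∀ {k n} (a c : G k) (b d : G n) → (a ++ b) ⊕ (c ++ d) ≡ (a ⊕ c) ++ (b ⊕ d)
⊕-++ a c b d = zipWith-++ _+₄_ a b c d

⊕-++-twice : ∀ {k n} (a c : G k) (b d : G n) →
  ((a ++ b) ⊕ (c ++ d)) ⊕ (c ++ d) ≡ ((a ⊕ c) ⊕ c) ++ ((b ⊕ d) ⊕ d)
⊕-++-twice a c b d = trans (cong (_⊕ (c ++ d)) (⊕-++ a c b d)) (⊕-++ (a ⊕ c) c (b ⊕ d) d)

0G-++ : ∀ k n → 0G {k + n} ≡ 0G {k} ++ 0G {n}
0G-++ zero    n = refl
0G-++ (suc k) n = cong (zero ∷_) (0G-++ k n)

double-++ : ∀ {k n} {d₁ : G k} {d₂ : G n} → d₁ ⊕ d₁ ≡ 0G → d₂ ⊕ d₂ ≡ 0G → (d₁ ++ d₂) ⊕ (d₁ ++ d₂) ≡ 0G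
double-++ {k} {n} {d₁} {d₂} 2d₁≡0 2d₂≡0 = begin
  (d₁ ++ d₂) ⊕ (d₁ ++ d₂)  ≡⟨ ⊕-++ d₁ d₁ d₂ d₂ ⟩
  (d₁ ⊕ d₁) ++ (d₂ ⊕ d₂)   ≡⟨ cong₂ _++_ 2d₁≡0 2d₂≡0 ⟩
  0G {k} ++ 0G {n}         ≡⟨ sym (0G-++ k n) ⟩
  0G                       ∎
  where open ≡-Reasoning

-- With x = a ++ b and d = d₁ ++ d₂, the progression projects to (a , d₁)
-- in A and (b , d₂) in A′; one of these is proper since 2d ≠ 0.
⊗-noProper3AP : ∀ {k n} (As : List (G k)) (Bs : List (G n)) →
  NoProper3AP As → NoProper3AP Bs → NoProper3AP (As ⊗ Bs)
⊗-noProper3AP {k} As Bs noAs noBs x d 2d≢0 x∈ x+d∈ x+2d∈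
  with a , b , a∈ , b∈ , refl ← ∈-cartesianProductWith⁻ _++_ As Bs x∈
  with d₁ , d₂ , refl ← splitAt k d
  with a+d∈ , b+d∈ ← ∈-⊗⁻ (subst (_∈ As ⊗ Bs) (⊕-++ a d₁ b d₂) x+d∈)
  with a+2d∈ , b+2d∈ ← ∈-⊗⁻ (subst (_∈ As ⊗ Bs) (⊕-++-twice a d₁ b d₂) x+2d∈)
  with (d₁ ⊕ d₁) ≟G 0G
... | no  2d₁≢0 = noAs a d₁ 2d₁≢0 a∈ a+d∈ a+2d∈
... | yes 2d₁≡0 = noBs b d₂ (λ 2d₂≡0 → 2d≢0 (double-++ 2d₁≡0 2d₂≡0)) b∈ b+d∈ b+2d∈

+₄-cancel : ∀ a b → a +₄ b ≡ a → b ≡ zero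
+₄-cancel = from-yes (all? λ a → all? λ b → (a +₄ b ≟F a) →-dec (b ≟F zero))

⊕-cancel : ∀ {n} (p d : G n) → p ⊕ d ≡ p → d ≡ 0G
⊕-cancel []      []      _  = refl
⊕-cancel (a ∷ p) (c ∷ d) eq = cong₂ _∷_ (+₄-cancel a c (∷-injectiveˡ eq)) (⊕-cancel p d (∷-injectiveʳ eq))

0G-double : ∀ {n} → 0G ⊕ 0G ≡ 0G {n}
0G-double {zero}  = refl
0G-double {suc n} = cong (zero ∷_) 0G-double

-- A single point contains no proper progression: x + d = x forces d = 0.
singleton-noProper3AP : ∀ {n} (p : G n) → NoProper3AP [ p ]
singleton-noProper3AP p x d 2d≢0 (here refl) (here p+d≡p) _ =
  2d≢0 (subst (λ e → e ⊕ e ≡ 0G) (sym (⊕-cancel p d p+d≡p)) 0G-double)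

singleton-unique : ∀ {a} {A : Set a} (p : A) → Unique [ p ]
singleton-unique p = [] ∷ []

construction : (n : ℕ) → List (G n)
construction (suc (suc (suc n))) = B ⊗ construction n
construction n                   = [ 0G ]

construction-unique : ∀ n → Unique (construction n)
construction-unique 0 = singleton-unique 0G
construction-unique 1 = singleton-unique 0G
construction-unique 2 = singleton-unique 0G
construction-unique (suc (suc (suc n))) = ⊗-unique B-unique (construction-unique n)

construction-noProper3AP : ∀ n → NoProper3AP (construction n)
construction-noProper3AP 0 = singleton-noProper3AP 0G
construction-noProper3AP 1 = singleton-noProper3AP 0G
construction-noProper3AP 2 = singleton-noProper3AP 0G
construction-noProper3AP (suc (suc (suc n))) =
  ⊗-noProper3AP B (construction n) B-noProper3AP (construction-noProper3AP n)

cube-rescale : ∀ a b L → a ^ 3 * (b * L ^ 3) ≡ b * (a * L) ^ 3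
cube-rescale = solve 3 (λ a b L → a :^ 3 :* (b :* L :^ 3) := b :* (a :* L) :^ 3) refl
  where open +-*-Solver

-- |Bᵐ × {0}|³ = 4096ᵐ ≥ 16^{3m+r} / 256 since r ≤ 2.
construction-size : ∀ n → 16 ^ n ≤ 256 * length (construction n) ^ 3
construction-size 0 = s≤s z≤n
construction-size 1 = m≤m+n 16 240
construction-size 2 = ≤-refl
construction-size (suc (suc (suc n))) = begin
  16 ^ (3 + n)                             ≡⟨ ^-distribˡ-+-* 16 3 n ⟩
  16 ^ 3 * 16 ^ n                          ≤⟨ *-monoʳ-≤ (16 ^ 3) (construction-size n) ⟩
  16 ^ 3 * (256 * L ^ 3)                   ≡⟨ cube-rescale 16 256 L ⟩
  256 * (16 * L) ^ 3                       ≡⟨ cong (λ m → 256 * m ^ 3) (sym (length-cartesianProductWith _++_ B (construction n))) ⟩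
  256 * length (construction (3 + n)) ^ 3  ∎
  where
  open ≤-Reasoning
  L : ℕ
  L = length (construction n)

-- The theorem, with implied constant 256: |A|³ ≥ |G|² / 256.
proposition12p2 : Σ ℕ λ k → (1 ≤ k) × ((n : ℕ) → Σ (List (G n)) λ A →
    Unique A × NoProper3AP A × (k * (length A ^ 3) ≥ 16 ^ n))
proposition12p2 = 256 , s≤s z≤n , λ n →
  construction n , construction-unique n , construction-noProper3AP n , construction-size n
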